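{- Let $X$ be an $n$-dimensional finite simplicial complex and let $k\le n-1$. Let $S$ be a finite nonempty set. Suppose that for each $(s,\sigma)\in S\times X(k)$ a $(k+1)$-chain $c_{s,\sigma}\in C_{k+1}(X)$ is given, and for each $(s,\tau)\in S\times X(k-1)$ a $k$-chain $c_{s,\tau}\in C_k(X)$ is given, such that for all $(s,\sigma)\in S\times X(k)$ $$\partial_{k+1}c_{s,\sigma}=\sigma+\sum_{j=0}^k c_{s,\sigma_j},$$ where $\sigma_0,\ldots,\sigma_k$ are the $(k-1)$-dimensional faces of $\sigma$. For $\tau\in X(k+1)$ let $\delta(\tau)=|\{(s,\sigma)\in S\times X(k):\tau\in\operatorname{supp}(c_{s,\sigma})\}|$. Then $$h^k(X)\ \ge\ \frac{|S|}{\max_{\tau\in X(k+1)}\delta(\tau)}.$$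
   Context: All chains and cochains have $\mathbb{Z}_2$ coefficients. $X(i)$ is the set of $i$-simplices, $C_i(X)$, $C^i(X)$ the chains and cochains, $\partial_i$ and $d_i$ the boundary and coboundary maps (non-reduced: $C^{ -1}(X)=0$), $B^k(X)=d_{k-1}C^{k-1}(X)$. The support of a chain/cochain is the set of simplices where it is nonzero and its norm $\|\cdot\|$ is the size of the support. The cosystolic norm is $\|\phi\|_{csy}=\min_{\psi\in C^{k-1}(X)}\|\phi+d_{k-1}\psi\|$, and $h^k(X)=\min\{\|d_k\phi\|/\|\phi\|_{csy}:\phi\in C^k(X)\setminus B^k(X)\}$. -}

module Defs where

open import Data.Nat using (ℕ; zero; suc; _≤_; _+_; _*_; _⊔_)
open import Data.Bool using (Bool; true; false; _xor_; _∧_; _∨_; not; if_then_else_)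
open import Data.Fin using (Fin)
open import Data.Fin.Subset using (Subset; _⊆_; ∣_∣; Nonempty)
open import Data.Vec using (Vec; []; _∷_)
open import Data.List using (List; []; _∷_; map; _++_; filterᵇ; length; foldr; allFin)
open import Data.Nat.ListAction using (sum)
open import Data.Product using (Σ; _×_; ∃; ∃-syntax; _,_)
open import Relation.Nullary using (¬_)
open import Relation.Binary.PropositionalEquality using (_≡_)
open import Data.Nat using (_≡ᵇ_)

allSubsets : (V : ℕ) → List (Subset V)
allSubsets zero = [] ∷ []
allSubsets (suc V) = map (false ∷_) (allSubsets V) ++ map (true ∷_) (allSubsets V)

_⊆ᵇ_ : ∀ {V} → Subset V → Subset V → Bool
[] ⊆ᵇ [] = true
(x ∷ xs) ⊆ᵇ (y ∷ ys) = (not x ∨ y) ∧ (xs ⊆ᵇ ys)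

_=ᵇ_ : ∀ {V} → Subset V → Subset V → Bool
[] =ᵇ [] = true
(x ∷ xs) =ᵇ (y ∷ ys) = not (x xor y) ∧ (xs =ᵇ ys)

record SimplicialComplex (V : ℕ) : Set where
  field
    face     : Subset V → Bool
    nonempty : ∀ σ → face σ ≡ true → Nonempty σ
    closed   : ∀ σ τ → face σ ≡ true → τ ⊆ σ → Nonempty τ → face τ ≡ true
open SimplicialComplex public

-- Faces of cardinality j, i.e. the simplices of dimension j - 1.
-- So X(i) = Faces X (suc i), and X(-1) = Faces X 0 = ∅ (non-reduced).
Faces : ∀ {V} → SimplicialComplex V → ℕ → List (Subset V)
Faces X j = filterᵇ (λ σ → face X σ ∧ (∣ σ ∣ ≡ᵇ j)) (allSubsets _)

_∈X[_]_ : ∀ {V} → Subset V → ℕ → SimplicialComplex V → Set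
σ ∈X[ i ] X = (face X σ ≡ true) × (∣ σ ∣ ≡ suc i)

HasDim : ∀ {V} → SimplicialComplex V → ℕ → Set
HasDim X n = (∃[ σ ] (σ ∈X[ n ] X)) × (∀ σ → face X σ ≡ true → ∣ σ ∣ ≤ suc n)

⊕ : List Bool → Bool
⊕ = foldr _xor_ false

-- (Co)chains with Z₂ coefficients are functions Subset V → Bool; an i-(co)chain is
-- determined by its values on X(i) (values elsewhere are ignored throughout).
Cochain : ℕ → Set
Cochain V = Subset V → Bool

norm : ∀ {V} → SimplicialComplex V → ℕ → Cochain V → ℕ
norm X i φ = length (filterᵇ φ (Faces X (suc i)))

-- Coboundary d_{i} : C^{i} → C^{i+1}; here given as function of the cardinality j = i+1
-- of the input simplices: (dφ)(τ) = Σ_{σ ∈ X, |σ| = j, σ ⊆ τ} φ(σ).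
-- d_{i-1} ψ for ψ ∈ C^{i-1} is cobd X i ψ  (so d_{-1} = 0 since Faces X 0 = ∅).
cobd : ∀ {V} → SimplicialComplex V → ℕ → Cochain V → Cochain V
cobd X j φ τ = ⊕ (map φ (filterᵇ (λ σ → σ ⊆ᵇ τ) (Faces X j)))

-- Boundary ∂_{i+1} : C_{i+1} → C_i:  (∂c)(ρ) = Σ_{τ ∈ X(i+1), ρ ⊆ τ} c(τ).
bd : ∀ {V} → SimplicialComplex V → ℕ → Cochain V → Cochain V
bd X i c ρ = ⊕ (map c (filterᵇ (λ τ → ρ ⊆ᵇ τ) (Faces X (suc (suc i)))))

EqOn : ∀ {V} → SimplicialComplex V → ℕ → Cochain V → Cochain V → Set
EqOn X k φ φ' = ∀ σ → σ ∈X[ k ] X → φ σ ≡ φ' σ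

InB : ∀ {V} → SimplicialComplex V → ℕ → Cochain V → Set
InB X k φ = ∃[ ψ ] EqOn X k φ (cobd X k ψ)

_+c_ : ∀ {V} → Cochain V → Cochain V → Cochain V
(φ +c ψ) σ = φ σ xor ψ σ

IsCsyNorm : ∀ {V} → SimplicialComplex V → ℕ → Cochain V → ℕ → Set
IsCsyNorm X k φ m =
  (∃[ ψ ] norm X k (φ +c cobd X k ψ) ≡ m) × (∀ ψ → m ≤ norm X k (φ +c cobd X k ψ))

-- "h^k(X) ≥ a / b", i.e. ‖d_k φ‖ / ‖φ‖_csy ≥ a / b for every φ ∈ C^k \ B^k,
-- written cross-multiplied (‖φ‖_csy > 0 for such φ; with b = 0 it says C^k = B^k,
-- in which case h^k = min ∅ = ∞).
hk≥ : ∀ {V} → SimplicialComplex V → ℕ → ℕ → ℕ → Set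
hk≥ X k a b = ∀ φ → ¬ InB X k φ → ∀ m → IsCsyNorm X k φ m →
  a * m ≤ b * norm X (suc k) (cobd X (suc k) φ)

δ : ∀ {V N} → SimplicialComplex V → ℕ → (Fin N → Subset V → Cochain V) → Subset V → ℕ
δ {N = N} X k c τ = sum (map (λ s → length (filterᵇ (λ σ → c s σ τ) (Faces X (suc k)))) (allFin N))

maxδ : ∀ {V N} → SimplicialComplex V → ℕ → (Fin N → Subset V → Cochain V) → ℕ
maxδ X k c = foldr _⊔_ 0 (map (δ X k c) (Faces X (suc (suc k))))

ChainCond : ∀ {V N} → SimplicialComplex V → ℕ →
  (Fin N → Subset V → Cochain V) → (Fin N → Subset V → Cochain V) → Set
ChainCond X k cσ cτ = ∀ s σ → σ ∈X[ k ] X → ∀ ρ → ρ ∈X[ k ] X →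
  bd X k (cσ s σ) ρ ≡
    (ρ =ᵇ σ) xor ⊕ (map (λ τ → cτ s τ ρ) (filterᵇ (λ τ → τ ⊆ᵇ σ) (Faces X k)))

module Submission where

-- Fix a k-cochain φ and write ⟨f , g⟩ for the Z₂-pairing Σ_x f(x) g(x).  For each
-- s ∈ S define the (k-1)-cochain ψ_s(τ) = ⟨φ , c_{s,τ}⟩.  Pairing φ with the chain
-- condition ∂c_{s,σ} = σ + Σ_j c_{s,σ_j} and using that ∂ and d are adjoint for the
-- pairing gives, for every σ ∈ X(k),
--     (φ + d ψ_s)(σ) = ⟨d φ , c_{s,σ}⟩ .
-- Hence ‖φ‖_csy ≤ ‖φ + d ψ_s‖ ≤ Σ_σ |supp(dφ) ∩ supp(c_{s,σ})| for each s, and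
-- summing over s and counting the pairs (s,σ) per τ ∈ supp(dφ) gives
--     |S| · ‖φ‖_csy ≤ Σ_{τ ∈ supp dφ} δ(τ) ≤ max δ · ‖dφ‖ .

open import Defs
open import Algebra.Bundles using (CommutativeSemiring; CommutativeRing)
open import Algebra.Structures using (IsCommutativeSemiring)
open import Data.Nat using (ℕ; zero; suc; _+_; _*_; _≤_; _⊔_; z≤n; s≤s; _≡ᵇ_)
open import Data.Nat.Properties
  using (+-*-isCommutativeSemiring; +-identityʳ; +-mono-≤; ≤-trans; *-monoˡ-≤;
         *-monoʳ-≤; *-comm; *-distribˡ-+; m≤m⊔n; m≤n⊔m; ≡ᵇ⇒≡; ≡⇒≡ᵇ; module ≤-Reasoning)
open import Data.Fin using (Fin)
open import Data.Fin.Subset using (Subset; ∣_∣)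
open import Data.Bool using (Bool; true; false; _xor_; _∧_; T; T?)
open import Data.Bool.Properties
  using (xor-∧-commutativeRing; ∧-distribˡ-xor; ∧-assoc; ∧-comm; ∧-zeroʳ; ∧-identityʳ;
         xor-identityʳ; T-∧; T-≡)
open import Data.List using (List; []; _∷_; map; _++_; filterᵇ; length; foldr; allFin)
open import Data.List.Properties using (map-cong; map-cong-local; map-++; map-∘; length-tabulate)
open import Data.List.Relation.Unary.All as All using (All)
open import Data.List.Relation.Unary.All.Properties using (all-filter)
open import Data.Nat.ListAction using (sum)
open import Data.Vec using ([]; _∷_)
open import Data.Product using (_,_)
open import Function using (_∘_; id; Equivalence)
open import Relation.Binary.PropositionalEquality

private
  variable
    A B : Set

module ListSum {C : Set} {_+_ _*_ : C → C → C} {0# 1# : C}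
               (isCS : IsCommutativeSemiring _≡_ _+_ _*_ 0# 1#) where

  private
    module R = IsCommutativeSemiring isCS
    semiring : CommutativeSemiring _ _
    semiring = record { isCommutativeSemiring = isCS }
  open import Algebra.Properties.CommutativeSemigroup
    (CommutativeSemiring.+-commutativeSemigroup semiring) using (interchange)

  Σ : List C → C
  Σ = foldr _+_ 0#

  Σ-cong : ∀ {f g : A → C} → f ≗ g → ∀ xs → Σ (map f xs) ≡ Σ (map g xs)
  Σ-cong f≗g xs = cong Σ (map-cong f≗g xs)

  Σ-congᴬ : ∀ {P : A → Set} {f g : A → C} {xs} →
    (∀ {x} → P x → f x ≡ g x) → All P xs → Σ (map f xs) ≡ Σ (map g xs)
  Σ-congᴬ f≡g ps = cong Σ (map-cong-local (All.map f≡g ps))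

  Σ-++ : ∀ xs ys → Σ (xs ++ ys) ≡ Σ xs + Σ ys
  Σ-++ []       ys = sym (R.+-identityˡ (Σ ys))
  Σ-++ (x ∷ xs) ys = trans (cong (x +_) (Σ-++ xs ys)) (sym (R.+-assoc x (Σ xs) (Σ ys)))

  Σ-0 : (xs : List A) → Σ (map (λ _ → 0#) xs) ≡ 0#
  Σ-0 []       = refl
  Σ-0 (x ∷ xs) = trans (cong (0# +_) (Σ-0 xs)) (R.+-identityʳ 0#)

  Σ-+ : ∀ (f g : A → C) xs → Σ (map (λ x → f x + g x) xs) ≡ Σ (map f xs) + Σ (map g xs)
  Σ-+ f g []       = sym (R.+-identityʳ 0#)
  Σ-+ f g (x ∷ xs) = trans (cong ((f x + g x) +_) (Σ-+ f g xs))
                           (interchange (f x) (g x) (Σ (map f xs)) (Σ (map g xs)))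

  Σ-swap : ∀ (f : A → B → C) xs ys →
    Σ (map (λ x → Σ (map (f x) ys)) xs) ≡ Σ (map (λ y → Σ (map (λ x → f x y) xs)) ys)
  Σ-swap f []       ys = sym (Σ-0 ys)
  Σ-swap f (x ∷ xs) ys = trans (cong (Σ (map (f x) ys) +_) (Σ-swap f xs ys))
                               (sym (Σ-+ (f x) (λ y → Σ (map (λ x → f x y) xs)) ys))

  Σ-*ˡ : ∀ a (f : A → C) xs → a * Σ (map f xs) ≡ Σ (map (λ x → a * f x) xs)
  Σ-*ˡ a f []       = R.zeroʳ a
  Σ-*ˡ a f (x ∷ xs) = trans (R.distribˡ a (f x) _) (cong ((a * f x) +_) (Σ-*ˡ a f xs))

  Σ-*ʳ : ∀ a (f : A → C) xs → Σ (map f xs) * a ≡ Σ (map (λ x → f x * a) xs)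
  Σ-*ʳ a f xs = trans (R.*-comm _ a) (trans (Σ-*ˡ a f xs) (Σ-cong (λ x → R.*-comm a (f x)) xs))

open ListSum (CommutativeRing.isCommutativeSemiring xor-∧-commutativeRing)
  using () renaming (Σ-cong to ⊕-cong; Σ-congᴬ to ⊕-congᴬ; Σ-++ to ⊕-++; Σ-0 to ⊕-0;
                     Σ-+ to ⊕-xor; Σ-swap to ⊕-swap; Σ-*ˡ to ∧-⊕; Σ-*ʳ to ⊕-∧)

open ListSum +-*-isCommutativeSemiring
  using () renaming (Σ-cong to sum-cong; Σ-congᴬ to sum-congᴬ; Σ-swap to sum-swap; Σ-*ˡ to *-sum)

⊕-filter : ∀ (p f : A → Bool) xs → ⊕ (map f (filterᵇ p xs)) ≡ ⊕ (map (λ x → p x ∧ f x) xs)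
⊕-filter p f []       = refl
⊕-filter p f (x ∷ xs) with p x
... | true  = cong (f x xor_) (⊕-filter p f xs)
... | false = ⊕-filter p f xs

⟨_,_⟩[_] : (A → Bool) → (A → Bool) → List A → Bool
⟨ f , g ⟩[ xs ] = ⊕ (map (λ x → f x ∧ g x) xs)

pair-xorʳ : ∀ (f g h : A → Bool) xs →
  ⟨ f , (λ x → g x xor h x) ⟩[ xs ] ≡ ⟨ f , g ⟩[ xs ] xor ⟨ f , h ⟩[ xs ]
pair-xorʳ f g h xs =
  trans (⊕-cong (λ x → ∧-distribˡ-xor (f x) (g x) (h x)) xs) (⊕-xor _ _ xs)

pair-⊕ʳ : ∀ (f : A → Bool) (g : B → A → Bool) xs ys →
  ⟨ f , (λ x → ⊕ (map (λ y → g y x) ys)) ⟩[ xs ] ≡ ⊕ (map (λ y → ⟨ f , g y ⟩[ xs ]) ys)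
pair-⊕ʳ f g xs ys =
  trans (⊕-cong (λ x → ∧-⊕ (f x) (λ y → g y x) ys) xs) (⊕-swap (λ x y → f x ∧ g y x) xs ys)

bd-cobd-adjoint : ∀ {V} (X : SimplicialComplex V) i (φ c : Cochain V) →
  ⟨ φ , bd X i c ⟩[ Faces X (suc i) ] ≡ ⟨ cobd X (suc i) φ , c ⟩[ Faces X (suc (suc i)) ]
bd-cobd-adjoint {V} X i φ c = begin
    ⟨ φ , bd X i c ⟩[ Fᵢ ]
  ≡⟨ ⊕-cong (λ ρ → cong (φ ρ ∧_) (⊕-filter (ρ ⊆ᵇ_) c Fᵢ₊₁)) Fᵢ ⟩
    ⟨ φ , (λ ρ → ⊕ (map (λ τ → (ρ ⊆ᵇ τ) ∧ c τ) Fᵢ₊₁)) ⟩[ Fᵢ ]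
  ≡⟨ pair-⊕ʳ φ (λ τ ρ → (ρ ⊆ᵇ τ) ∧ c τ) Fᵢ Fᵢ₊₁ ⟩
    ⊕ (map (λ τ → ⊕ (map (λ ρ → φ ρ ∧ ((ρ ⊆ᵇ τ) ∧ c τ)) Fᵢ)) Fᵢ₊₁)
  ≡⟨ ⊕-cong (λ τ → ⊕-cong (λ ρ → reassociate (φ ρ) (ρ ⊆ᵇ τ) (c τ)) Fᵢ) Fᵢ₊₁ ⟩
    ⊕ (map (λ τ → ⊕ (map (λ ρ → ((ρ ⊆ᵇ τ) ∧ φ ρ) ∧ c τ) Fᵢ)) Fᵢ₊₁)
  ≡⟨ ⊕-cong (λ τ → sym (trans (cong (_∧ c τ) (⊕-filter (_⊆ᵇ τ) φ Fᵢ)) (⊕-∧ (c τ) _ Fᵢ))) Fᵢ₊₁ ⟩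
    ⟨ cobd X (suc i) φ , c ⟩[ Fᵢ₊₁ ]
  ∎
  where
  open ≡-Reasoning
  Fᵢ Fᵢ₊₁ : List (Subset V)
  Fᵢ   = Faces X (suc i)
  Fᵢ₊₁ = Faces X (suc (suc i))
  reassociate : ∀ a b c → a ∧ (b ∧ c) ≡ (b ∧ a) ∧ c
  reassociate a b c = trans (sym (∧-assoc a b c)) (cong (_∧ c) (∧-comm a b))

isSimplexᵇ : ∀ {V} → SimplicialComplex V → ℕ → Subset V → Bool
isSimplexᵇ X j σ = face X σ ∧ (∣ σ ∣ ≡ᵇ j)

isSimplexᵇ-sound : ∀ {V} (X : SimplicialComplex V) i {σ} →
  T (isSimplexᵇ X (suc i) σ) → σ ∈X[ i ] X
isSimplexᵇ-sound X i t =
  let (isFace , hasSize) = Equivalence.to T-∧ t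
  in Equivalence.to T-≡ isFace , ≡ᵇ⇒≡ _ _ hasSize

isSimplexᵇ-complete : ∀ {V} (X : SimplicialComplex V) i {σ} →
  σ ∈X[ i ] X → isSimplexᵇ X (suc i) σ ≡ true
isSimplexᵇ-complete X i (isFace , hasSize) =
  Equivalence.to T-≡ (Equivalence.from T-∧ (Equivalence.from T-≡ isFace , ≡⇒≡ᵇ _ _ hasSize))

Faces⊆X : ∀ {V} (X : SimplicialComplex V) i → All (_∈X[ i ] X) (Faces X (suc i))
Faces⊆X {V} X i =
  All.map (isSimplexᵇ-sound X i) (all-filter (T? ∘ isSimplexᵇ X (suc i)) (allSubsets V))

⊕-allSubsets-suc : ∀ V (f : Subset (suc V) → Bool) →
  ⊕ (map f (allSubsets (suc V)))
    ≡ ⊕ (map (f ∘ (false ∷_)) (allSubsets V)) xor ⊕ (map (f ∘ (true ∷_)) (allSubsets V))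
⊕-allSubsets-suc V f =
  trans (cong ⊕ (map-++ f (map (false ∷_) S) (map (true ∷_) S)))
    (trans (⊕-++ (map f (map (false ∷_) S)) _)
      (cong₂ _xor_ (cong ⊕ (sym (map-∘ S))) (cong ⊕ (sym (map-∘ S)))))
  where
  S : List (Subset V)
  S = allSubsets V

⊕-∧false : ∀ (g : A → Bool) xs → ⊕ (map (λ x → g x ∧ false) xs) ≡ false
⊕-∧false g xs = trans (⊕-cong (λ x → ∧-zeroʳ (g x)) xs) (⊕-0 xs)

-- Each subset occurs exactly once in allSubsets, so summing h against the
-- indicator of σ picks out h σ.
⊕-allSubsets-point : ∀ V (h : Subset V → Bool) σ →
  ⊕ (map (λ ρ → h ρ ∧ (ρ =ᵇ σ)) (allSubsets V)) ≡ h σ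
⊕-allSubsets-point zero    h []      = trans (xor-identityʳ _) (∧-identityʳ (h []))
⊕-allSubsets-point (suc V) h (false ∷ σ) =
  trans (⊕-allSubsets-suc V _)
    (trans (cong₂ _xor_ (⊕-allSubsets-point V (h ∘ (false ∷_)) σ)
                        (⊕-∧false (h ∘ (true ∷_)) (allSubsets V)))
           (xor-identityʳ _))
⊕-allSubsets-point (suc V) h (true ∷ σ) =
  trans (⊕-allSubsets-suc V _)
    (cong₂ _xor_ (⊕-∧false (h ∘ (false ∷_)) (allSubsets V))
                 (⊕-allSubsets-point V (h ∘ (true ∷_)) σ))

pair-point : ∀ {V} (X : SimplicialComplex V) i (φ : Cochain V) σ → σ ∈X[ i ] X →
  ⟨ φ , (_=ᵇ σ) ⟩[ Faces X (suc i) ] ≡ φ σ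
pair-point {V} X i φ σ σ∈X = begin
    ⟨ φ , (_=ᵇ σ) ⟩[ Faces X (suc i) ]
  ≡⟨ ⊕-filter p _ (allSubsets V) ⟩
    ⊕ (map (λ ρ → p ρ ∧ (φ ρ ∧ (ρ =ᵇ σ))) (allSubsets V))
  ≡⟨ ⊕-cong (λ ρ → sym (∧-assoc (p ρ) (φ ρ) (ρ =ᵇ σ))) (allSubsets V) ⟩
    ⊕ (map (λ ρ → (p ρ ∧ φ ρ) ∧ (ρ =ᵇ σ)) (allSubsets V))
  ≡⟨ ⊕-allSubsets-point V (λ ρ → p ρ ∧ φ ρ) σ ⟩
    p σ ∧ φ σ
  ≡⟨ cong (_∧ φ σ) (isSimplexᵇ-complete X i σ∈X) ⟩
    φ σ
  ∎
  where
  open ≡-Reasoning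
  p : Subset V → Bool
  p = isSimplexᵇ X (suc i)

⟦_⟧ : Bool → ℕ
⟦ true  ⟧ = 1
⟦ false ⟧ = 0

⟦∧⟧ : ∀ a b → ⟦ a ∧ b ⟧ ≡ ⟦ a ⟧ * ⟦ b ⟧
⟦∧⟧ false b = refl
⟦∧⟧ true  b = sym (+-identityʳ ⟦ b ⟧)

length-filterᵇ : ∀ (p : A → Bool) xs → length (filterᵇ p xs) ≡ sum (map (⟦_⟧ ∘ p) xs)
length-filterᵇ p []       = refl
length-filterᵇ p (x ∷ xs) with p x
... | true  = cong suc (length-filterᵇ p xs)
... | false = length-filterᵇ p xs

-- A Z₂-sum is 1 only if at least one summand is 1.
⟦⊕⟧≤ : ∀ (f : A → Bool) xs → ⟦ ⊕ (map f xs) ⟧ ≤ sum (map (⟦_⟧ ∘ f) xs)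
⟦⊕⟧≤ f []       = z≤n
⟦⊕⟧≤ f (x ∷ xs) with f x | ⟦⊕⟧≤ f xs
... | false | rest = rest
... | true  | rest with ⊕ (map f xs)
...   | true  = z≤n
...   | false = s≤s z≤n

sum-mono : ∀ {f g : A → ℕ} → (∀ x → f x ≤ g x) → ∀ xs → sum (map f xs) ≤ sum (map g xs)
sum-mono f≤g []       = z≤n
sum-mono f≤g (x ∷ xs) = +-mono-≤ (f≤g x) (sum-mono f≤g xs)

length*≤sum : ∀ m (f : A → ℕ) xs → (∀ x → m ≤ f x) → length xs * m ≤ sum (map f xs)
length*≤sum m f []       m≤f = z≤n
length*≤sum m f (x ∷ xs) m≤f = +-mono-≤ (m≤f x) (length*≤sum m f xs m≤f)

weighted-sum≤max : ∀ (w f : A → ℕ) xs →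
  sum (map (λ x → w x * f x) xs) ≤ foldr _⊔_ 0 (map f xs) * sum (map w xs)
weighted-sum≤max w f []       = z≤n
weighted-sum≤max w f (x ∷ xs) = begin
    w x * f x + sum (map (λ x → w x * f x) xs)
  ≤⟨ +-mono-≤ (*-monoʳ-≤ (w x) (m≤m⊔n (f x) M))
              (≤-trans (weighted-sum≤max w f xs) (*-monoˡ-≤ (sum (map w xs)) (m≤n⊔m (f x) M))) ⟩
    w x * (f x ⊔ M) + (f x ⊔ M) * sum (map w xs)
  ≡⟨ cong (_+ (f x ⊔ M) * sum (map w xs)) (*-comm (w x) (f x ⊔ M)) ⟩
    (f x ⊔ M) * w x + (f x ⊔ M) * sum (map w xs)
  ≡⟨ sym (*-distribˡ-+ (f x ⊔ M) (w x) (sum (map w xs))) ⟩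
    (f x ⊔ M) * sum (map w (x ∷ xs))
  ∎
  where
  open ≤-Reasoning
  M : ℕ
  M = foldr _⊔_ 0 (map f xs)

module ConeBound {V} (X : SimplicialComplex V) (k N : ℕ)
                 (cσ cτ : Fin N → Subset V → Cochain V) (chain : ChainCond X k cσ cτ)
                 (φ : Cochain V) where

  private
    F₀ F₁ F₂ : List (Subset V)
    F₀ = Faces X k
    F₁ = Faces X (suc k)
    F₂ = Faces X (suc (suc k))

  dφ : Cochain V
  dφ = cobd X (suc k) φ

  ψ : Fin N → Cochain V
  ψ s τ = ⟨ φ , cτ s τ ⟩[ F₁ ]

  shifted-value : ∀ s σ → σ ∈X[ k ] X → (φ +c cobd X k (ψ s)) σ ≡ ⟨ dφ , cσ s σ ⟩[ F₂ ]
  shifted-value s σ σ∈X = begin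
      φ σ xor ⊕ (map (λ τ → ⟨ φ , cτ s τ ⟩[ F₁ ]) facets)
    ≡⟨ cong₂ _xor_ (sym (pair-point X k φ σ σ∈X)) (sym (pair-⊕ʳ φ (cτ s) F₁ facets)) ⟩
      ⟨ φ , (_=ᵇ σ) ⟩[ F₁ ] xor ⟨ φ , conesOnFacets ⟩[ F₁ ]
    ≡⟨ sym (pair-xorʳ φ (_=ᵇ σ) conesOnFacets F₁) ⟩
      ⟨ φ , (λ ρ → (ρ =ᵇ σ) xor conesOnFacets ρ) ⟩[ F₁ ]
    ≡⟨ ⊕-congᴬ (λ ρ∈X → cong (φ _ ∧_) (sym (chain s σ σ∈X _ ρ∈X))) (Faces⊆X X k) ⟩
      ⟨ φ , bd X k (cσ s σ) ⟩[ F₁ ]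
    ≡⟨ bd-cobd-adjoint X k φ (cσ s σ) ⟩
      ⟨ dφ , cσ s σ ⟩[ F₂ ]
    ∎
    where
    open ≡-Reasoning
    facets : List (Subset V)
    facets = filterᵇ (_⊆ᵇ σ) F₀
    conesOnFacets : Cochain V
    conesOnFacets ρ = ⊕ (map (λ τ → cτ s τ ρ) facets)

  incidence : Fin N → Subset V → Subset V → ℕ
  incidence s σ τ = ⟦ dφ τ ∧ cσ s σ τ ⟧

  shifted-norm≤ : ∀ s →
    norm X k (φ +c cobd X k (ψ s)) ≤ sum (map (λ σ → sum (map (incidence s σ) F₂)) F₁)
  shifted-norm≤ s = begin
      norm X k (φ +c cobd X k (ψ s))
    ≡⟨ length-filterᵇ _ F₁ ⟩
      sum (map (⟦_⟧ ∘ (φ +c cobd X k (ψ s))) F₁)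
    ≡⟨ sum-congᴬ (λ σ∈X → cong ⟦_⟧ (shifted-value s _ σ∈X)) (Faces⊆X X k) ⟩
      sum (map (λ σ → ⟦ ⟨ dφ , cσ s σ ⟩[ F₂ ] ⟧) F₁)
    ≤⟨ sum-mono (λ σ → ⟦⊕⟧≤ (λ τ → dφ τ ∧ cσ s σ τ) F₂) F₁ ⟩
      sum (map (λ σ → sum (map (incidence s σ) F₂)) F₁)
    ∎
    where open ≤-Reasoning

  incidences-at : ∀ τ →
    sum (map (λ s → sum (map (λ σ → incidence s σ τ) F₁)) (allFin N)) ≡ ⟦ dφ τ ⟧ * δ X k cσ τ
  incidences-at τ = begin
      sum (map (λ s → sum (map (λ σ → ⟦ dφ τ ∧ cσ s σ τ ⟧) F₁)) (allFin N))
    ≡⟨ sum-cong (λ s → sum-cong (λ σ → ⟦∧⟧ (dφ τ) (cσ s σ τ)) F₁) (allFin N) ⟩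
      sum (map (λ s → sum (map (λ σ → ⟦ dφ τ ⟧ * ⟦ cσ s σ τ ⟧) F₁)) (allFin N))
    ≡⟨ sum-cong (λ s → sym (*-sum ⟦ dφ τ ⟧ (λ σ → ⟦ cσ s σ τ ⟧) F₁)) (allFin N) ⟩
      sum (map (λ s → ⟦ dφ τ ⟧ * sum (map (λ σ → ⟦ cσ s σ τ ⟧) F₁)) (allFin N))
    ≡⟨ sym (*-sum ⟦ dφ τ ⟧ (λ s → sum (map (λ σ → ⟦ cσ s σ τ ⟧) F₁)) (allFin N)) ⟩
      ⟦ dφ τ ⟧ * sum (map (λ s → sum (map (λ σ → ⟦ cσ s σ τ ⟧) F₁)) (allFin N))
    ≡⟨ cong (⟦ dφ τ ⟧ *_)
            (sym (sum-cong (λ s → length-filterᵇ (λ σ → cσ s σ τ) F₁) (allFin N))) ⟩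
      ⟦ dφ τ ⟧ * δ X k cσ τ
    ∎
    where open ≡-Reasoning

  count-incidences :
    sum (map (λ s → sum (map (λ σ → sum (map (incidence s σ) F₂)) F₁)) (allFin N))
      ≡ sum (map (λ τ → ⟦ dφ τ ⟧ * δ X k cσ τ) F₂)
  count-incidences = begin
      sum (map (λ s → sum (map (λ σ → sum (map (incidence s σ) F₂)) F₁)) (allFin N))
    ≡⟨ sum-cong (λ s → sum-swap (incidence s) F₁ F₂) (allFin N) ⟩
      sum (map (λ s → sum (map (λ τ → sum (map (λ σ → incidence s σ τ) F₁)) F₂)) (allFin N))
    ≡⟨ sum-swap (λ s τ → sum (map (λ σ → incidence s σ τ) F₁)) (allFin N) F₂ ⟩
      sum (map (λ τ → sum (map (λ s → sum (map (λ σ → incidence s σ τ) F₁)) (allFin N))) F₂)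
    ≡⟨ sum-cong incidences-at F₂ ⟩
      sum (map (λ τ → ⟦ dφ τ ⟧ * δ X k cσ τ) F₂)
    ∎
    where open ≡-Reasoning

  bound : ∀ m → (∀ ψ′ → m ≤ norm X k (φ +c cobd X k ψ′)) →
    N * m ≤ maxδ X k cσ * norm X (suc k) dφ
  bound m m≤norm = begin
      N * m
    ≡⟨ cong (_* m) (sym (length-tabulate {n = N} id)) ⟩
      length (allFin N) * m
    ≤⟨ length*≤sum m _ (allFin N) (λ s → ≤-trans (m≤norm (ψ s)) (shifted-norm≤ s)) ⟩
      sum (map (λ s → sum (map (λ σ → sum (map (incidence s σ) F₂)) F₁)) (allFin N))
    ≡⟨ count-incidences ⟩
      sum (map (λ τ → ⟦ dφ τ ⟧ * δ X k cσ τ) F₂)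
    ≤⟨ weighted-sum≤max (⟦_⟧ ∘ dφ) (δ X k cσ) F₂ ⟩
      maxδ X k cσ * sum (map (⟦_⟧ ∘ dφ) F₂)
    ≡⟨ cong (maxδ X k cσ *_) (sym (length-filterᵇ dφ F₂)) ⟩
      maxδ X k cσ * norm X (suc k) dφ
    ∎
    where open ≤-Reasoning

-- Corollary 2.6: h^k(X) ≥ |S| / max_τ δ(τ).  The bound holds for every k-cochain φ.
corollary2p6 : ∀ {V : ℕ} (X : SimplicialComplex V) (n k : ℕ) → HasDim X n → k + 1 ≤ n →
    (N : ℕ) → 1 ≤ N →
    (cσ : Fin N → Subset V → Cochain V) (cτ : Fin N → Subset V → Cochain V) →
    ChainCond X k cσ cτ →
    hk≥ X k N (maxδ X k cσ)
corollary2p6 X n k _ _ N _ cσ cτ chain φ _ m (_ , m≤norm) =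
  ConeBound.bound X k N cσ cτ chain φ m m≤norm
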